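{- Let $\Gamma$, $\Delta$ and $\Theta$ be contexts. (i) If $\{\Gamma\}\subseteq\{\Delta\}$ then $\Gamma\le^a\Delta$. (ii) If $\Gamma\le^a\Delta$ then $\Theta,\Gamma\le^a\Theta,\Delta$ (where $\Theta$ is disjoint from $\Gamma$ and $\Delta$).
   Context: Simply typed $\lambda$-calculus over base type $0$; every type is uniquely $[A_1,\dots,A_n]:=A_1\to\cdots\to A_n\to0$. A context is a finite list of distinct typed variables, $\{\Gamma\}$ its set of typed variables; terms identified up to $\beta\eta$ ($=_{\beta\eta}$); $\Lambda^\Xi(A)$ = terms of type $A$ with free variables in $\{\Xi\}$. A substitution $\varrho$ from $\Gamma$ to $\Delta$ assigns $\varrho_c\in\Lambda^\Delta(C)$ to each $c^C\in\{\Gamma\}$; for a fresh context $\Xi$, $\varrho^\Xi$ is $\varrho$ on $\{\Gamma\}$ and the identity on $\{\Xi\}$. $\varrho$ is an atomic reduction if for every fresh context $\Xi$, all $a^A,b^B\in\{\Xi,\Gamma\}$ with $A\equiv[A_1,\dots,A_n]$, $B\equiv[B_1,\dots,B_m]$, and all $M_i\in\Lambda^{\Xi,\Delta}(A_i)$, $N_i\in\Lambda^{\Xi,\Delta}(B_i)$: $\varrho^\Xi_aM_1\cdots M_n=_{\beta\eta}\varrho^\Xi_bN_1\cdots N_m$ implies $a=b$ and all $M_i=N_i$. $\Gamma\le^a\Delta$ means such an atomic reduction from $\Gamma$ to $\Delta$ exists. -}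

module Defs where

open import Data.Nat using (ℕ) renaming (_≟_ to _≟ℕ_)
open import Data.List using (List; []; _∷_; _++_)
open import Data.List.Relation.Unary.All using (All; []; _∷_)
open import Data.List.Relation.Unary.Any using (here; there)
open import Data.List.Relation.Unary.Unique.Propositional using (Unique)
open import Data.List.Relation.Binary.Disjoint.Propositional using (Disjoint)
open import Data.List.Membership.Propositional using (_∈_)
open import Data.List.Membership.Propositional.Properties using (∈-++⁺ˡ; ∈-++⁺ʳ; ∈-++⁻)
open import Data.Product using (_×_; _,_)
open import Data.Sum using (inj₁; inj₂)
open import Data.Empty using (⊥-elim)
open import Relation.Nullary using (yes; no; ¬_)
open import Relation.Binary.Definitions using (DecidableEquality)
open import Relation.Binary.PropositionalEquality using (_≡_; refl)

-- Simple types over one base type 0.  Every type is uniquely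
-- [A₁,…,Aₙ] := A₁ → ⋯ → Aₙ → 0, represented as  ar (A₁ ∷ ⋯ ∷ Aₙ ∷ []).

data Ty : Set where
  ar : List Ty → Ty

o : Ty
o = ar []

dom : Ty → List Ty
dom (ar As) = As

mutual
  _≟T_ : DecidableEquality Ty
  ar As ≟T ar Bs with As ≟Ts Bs
  ... | yes refl = yes refl
  ... | no ne = no λ { refl → ne refl }

  _≟Ts_ : DecidableEquality (List Ty)
  [] ≟Ts [] = yes refl
  [] ≟Ts (_ ∷ _) = no λ ()
  (_ ∷ _) ≟Ts [] = no λ ()
  (A ∷ As) ≟Ts (B ∷ Bs) with A ≟T B | As ≟Ts Bs
  ... | yes refl | yes refl = yes refl
  ... | no ne | _ = no λ { refl → ne refl }
  ... | yes _ | no ne = no λ { refl → ne refl }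

-- A context is a
-- list of typed variables; distinctness is the hypothesis  Unique Γ.
-- {Γ} is the set of typed variables, i.e. membership  x ∈ Γ.

record Var : Set where
  constructor _^_
  field
    name : ℕ
    ty   : Ty
open Var public

_≟V_ : DecidableEquality Var
(n ^ A) ≟V (m ^ B) with n ≟ℕ m | A ≟T B
... | yes refl | yes refl = yes refl
... | no ne | _ = no λ { refl → ne refl }
... | yes _ | no ne = no λ { refl → ne refl }

open import Data.List.Membership.DecPropositional _≟V_ using (_∈?_)

-- Terms (locally nameless): free variables are typed variables from a
-- context Γ (membership proof irrelevant), bound variables are de Bruijn
-- indices into a list Φ of types.

data Tm (Γ : List Var) (Φ : List Ty) : Ty → Set where
  fvar : (x : Var) → .(x ∈ Γ) → Tm Γ Φ (ty x)
  bvar : ∀ {A} → A ∈ Φ → Tm Γ Φ A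
  lam  : ∀ {A Bs} → Tm Γ (A ∷ Φ) (ar Bs) → Tm Γ Φ (ar (A ∷ Bs))
  app  : ∀ {A Bs} → Tm Γ Φ (ar (A ∷ Bs)) → Tm Γ Φ A → Tm Γ Φ (ar Bs)

Λ : List Var → Ty → Set
Λ Γ A = Tm Γ [] A

BRen : List Ty → List Ty → Set
BRen Φ Ψ = ∀ {A} → A ∈ Φ → A ∈ Ψ

bext : ∀ {Φ Ψ B} → BRen Φ Ψ → BRen (B ∷ Φ) (B ∷ Ψ)
bext r (here p) = here p
bext r (there i) = there (r i)

bren : ∀ {Γ Φ Ψ A} → BRen Φ Ψ → Tm Γ Φ A → Tm Γ Ψ A
bren r (fvar x p) = fvar x p
bren r (bvar i) = bvar (r i)
bren r (lam t) = lam (bren (bext r) t)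
bren r (app t u) = app (bren r t) (bren r u)

BSub : List Var → List Ty → List Ty → Set
BSub Γ Φ Ψ = ∀ {A} → A ∈ Φ → Tm Γ Ψ A

bsext : ∀ {Γ Φ Ψ B} → BSub Γ Φ Ψ → BSub Γ (B ∷ Φ) (B ∷ Ψ)
bsext s (here refl) = bvar (here refl)
bsext s (there i) = bren there (s i)

bsub : ∀ {Γ Φ Ψ A} → BSub Γ Φ Ψ → Tm Γ Φ A → Tm Γ Ψ A
bsub s (fvar x p) = fvar x p
bsub s (bvar i) = s i
bsub s (lam t) = lam (bsub (bsext s) t)
bsub s (app t u) = app (bsub s t) (bsub s u)

single : ∀ {Γ Φ B} → Tm Γ Φ B → BSub Γ (B ∷ Φ) Φ
single u (here refl) = u
single u (there i) = bvar i

_[_] : ∀ {Γ Φ A B} → Tm Γ (B ∷ Φ) A → Tm Γ Φ B → Tm Γ Φ A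
t [ u ] = bsub (single u) t

infix 4 _≈_
data _≈_ {Γ : List Var} : ∀ {Φ A} → Tm Γ Φ A → Tm Γ Φ A → Set where
  ≈refl  : ∀ {Φ A} {t : Tm Γ Φ A} → t ≈ t
  ≈sym   : ∀ {Φ A} {t u : Tm Γ Φ A} → t ≈ u → u ≈ t
  ≈trans : ∀ {Φ A} {t u v : Tm Γ Φ A} → t ≈ u → u ≈ v → t ≈ v
  ≈lam   : ∀ {Φ A Bs} {t u : Tm Γ (A ∷ Φ) (ar Bs)} → t ≈ u → lam t ≈ lam u
  ≈app   : ∀ {Φ A Bs} {t t' : Tm Γ Φ (ar (A ∷ Bs))} {u u' : Tm Γ Φ A} →
           t ≈ t' → u ≈ u' → app t u ≈ app t' u'
  β      : ∀ {Φ A Bs} (t : Tm Γ (A ∷ Φ) (ar Bs)) (u : Tm Γ Φ A) →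
           app (lam t) u ≈ t [ u ]
  η      : ∀ {Φ A Bs} (t : Tm Γ Φ (ar (A ∷ Bs))) →
           t ≈ lam (app (bren there t) (bvar (here refl)))

fren : ∀ {Γ Δ Φ A} → (∀ {x} → x ∈ Γ → x ∈ Δ) → Tm Γ Φ A → Tm Δ Φ A
fren r (fvar x p) = fvar x (r p)
fren r (bvar i) = bvar i
fren r (lam t) = lam (fren r t)
fren r (app t u) = app (fren r t) (fren r u)

apps : ∀ {Γ Φ A} → Tm Γ Φ A → All (Tm Γ Φ) (dom A) → Tm Γ Φ o
apps {A = ar []} t [] = t
apps {A = ar (_ ∷ _)} t (m ∷ ms) = apps (app t m) ms

-- pointwise βη-equality of argument spines (forces equal lists of types)
data ArgsEq {Γ : List Var} : ∀ {As Bs} → All (Tm Γ []) As → All (Tm Γ []) Bs → Set where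
  []  : ArgsEq [] []
  _∷_ : ∀ {A As Bs} {M N : Tm Γ [] A} {Ms : All (Tm Γ []) As} {Ns : All (Tm Γ []) Bs} →
        M ≈ N → ArgsEq Ms Ns → ArgsEq (M ∷ Ms) (N ∷ Ns)

Subst : List Var → List Var → Set
Subst Γ Δ = (c : Var) → .(c ∈ Γ) → Λ Δ (ty c)

private
  inRight : ∀ {c} (Ξ Γ : List Var) → c ∈ Ξ ++ Γ → ¬ (c ∈ Ξ) → c ∈ Γ
  inRight Ξ Γ p q with ∈-++⁻ Ξ p
  ... | inj₁ r = ⊥-elim (q r)
  ... | inj₂ r = r

_^ext_ : ∀ {Γ Δ} → Subst Γ Δ → (Ξ : List Var) → Subst (Ξ ++ Γ) (Ξ ++ Δ)
(_^ext_ {Γ} {Δ} ρ Ξ) c p with c ∈? Ξ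
... | yes q = fvar c (∈-++⁺ˡ q)
... | no q  = fren (∈-++⁺ʳ Ξ) (ρ c (inRight Ξ Γ p q))

Fresh : List Var → List Var → List Var → Set
Fresh Ξ Γ Δ = Unique Ξ × Disjoint Ξ Γ × Disjoint Ξ Δ

IsAtomicReduction : (Γ Δ : List Var) → Subst Γ Δ → Set
IsAtomicReduction Γ Δ ρ =
  ∀ (Ξ : List Var) → Fresh Ξ Γ Δ →
  ∀ (a b : Var) (pa : a ∈ Ξ ++ Γ) (pb : b ∈ Ξ ++ Γ)
    (Ms : All (Λ (Ξ ++ Δ)) (dom (ty a))) (Ns : All (Λ (Ξ ++ Δ)) (dom (ty b))) →
    apps ((ρ ^ext Ξ) a pa) Ms ≈ apps ((ρ ^ext Ξ) b pb) Ns →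
    a ≡ b × ArgsEq Ms Ns

record _≤ᵃ_ (Γ Δ : List Var) : Set where
  constructor mk≤ᵃ
  field
    ρ      : Subst Γ Δ
    atomic : IsAtomicReduction Γ Δ ρ

module Submission where

-- (i) For the inclusion substitution, atomicity says that βη-equality
-- x M₁ ⋯ Mₙ = y N₁ ⋯ Nₘ of neutral terms headed by free variables forces
-- x = y and Mᵢ = Nᵢ.  This is read off normal forms: normalization by
-- evaluation (a Kripke model with a PER for completeness, a logical relation
-- for soundness) sends x M₁ ⋯ Mₙ to the normal neutral x (nf M₁) ⋯ (nf Mₙ).
-- (ii) If ϱ is atomic then so is ϱ^Θ, because (ϱ^Θ)^Ξ coincides with
-- ϱ^(Ξ,Θ) up to reassociating Ξ,Θ,Δ, and Ξ,Θ is a fresh context for Γ and Δ.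

open import Defs
open import Data.List using (List; []; _∷_; _++_)
open import Data.List.Properties using (++-assoc)
open import Data.List.Relation.Unary.All using (All; []; _∷_)
import Data.List.Relation.Unary.All as All
open import Data.List.Relation.Unary.Any using (here; there)
open import Data.List.Relation.Unary.Unique.Propositional using (Unique)
open import Data.List.Relation.Unary.Unique.Propositional.Properties using (++⁺)
open import Data.List.Relation.Binary.Disjoint.Propositional using (Disjoint)
open import Data.List.Relation.Binary.Subset.Propositional using (_⊆_)
open import Data.List.Relation.Binary.Subset.Propositional.Properties using (++⁺ʳ)
open import Data.List.Membership.Propositional using (_∈_)
open import Data.List.Membership.Propositional.Properties using (∈-++⁺ˡ; ∈-++⁺ʳ; ∈-++⁻)
open import Data.List.Membership.DecPropositional _≟V_ using (_∈?_)
open import Data.Product using (Σ; _×_; _,_; proj₁; proj₂)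
open import Data.Sum using (inj₁; inj₂)
open import Data.Unit using (⊤; tt)
open import Data.Empty using (⊥-elim)
open import Relation.Nullary using (Dec; yes; no; ¬_)
open import Relation.Binary.PropositionalEquality
  using (_≡_; refl; sym; trans; cong; cong₂; subst; subst₂; module ≡-Reasoning)

infix 4 _≗ʳ_
infixr 9 _∘ʳ_

_≗ʳ_ : ∀ {Φ Ψ} → BRen Φ Ψ → BRen Φ Ψ → Set
r ≗ʳ r' = ∀ {A} (i : A ∈ _) → r {A} i ≡ r' i

idʳ : ∀ {Φ} → BRen Φ Φ
idʳ i = i

_∘ʳ_ : ∀ {Φ Ψ Ω} → BRen Ψ Ω → BRen Φ Ψ → BRen Φ Ω
(r' ∘ʳ r) i = r' (r i)

bext-cong : ∀ {Φ Ψ B} {r r' : BRen Φ Ψ} → r ≗ʳ r' → bext {B = B} r ≗ʳ bext r'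
bext-cong e (here p) = refl
bext-cong e (there i) = cong there (e i)

bext-id : ∀ {Φ B} → bext {Φ} {Φ} {B} idʳ ≗ʳ idʳ
bext-id (here p) = refl
bext-id (there i) = refl

bext-∘ : ∀ {Φ Ψ Ω B} (r' : BRen Ψ Ω) (r : BRen Φ Ψ) → bext {B = B} r' ∘ʳ bext r ≗ʳ bext (r' ∘ʳ r)
bext-∘ r' r (here p) = refl
bext-∘ r' r (there i) = refl

module _ {Γ : List Var} where

  bren-cong : ∀ {Φ Ψ A} {r r' : BRen Φ Ψ} → r ≗ʳ r' → (t : Tm Γ Φ A) → bren r t ≡ bren r' t
  bren-cong e (fvar x p) = refl
  bren-cong e (bvar i) = cong bvar (e i)
  bren-cong e (lam t) = cong lam (bren-cong (bext-cong e) t)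
  bren-cong e (app t u) = cong₂ app (bren-cong e t) (bren-cong e u)

  bren-∘ : ∀ {Φ Ψ Ω A} (r' : BRen Ψ Ω) (r : BRen Φ Ψ) (t : Tm Γ Φ A) →
    bren r' (bren r t) ≡ bren (r' ∘ʳ r) t
  bren-∘ r' r (fvar x p) = refl
  bren-∘ r' r (bvar i) = refl
  bren-∘ r' r (lam t) = cong lam (trans (bren-∘ (bext r') (bext r) t) (bren-cong (bext-∘ r' r) t))
  bren-∘ r' r (app t u) = cong₂ app (bren-∘ r' r t) (bren-∘ r' r u)

  bren-id : ∀ {Φ A} (t : Tm Γ Φ A) → bren idʳ t ≡ t
  bren-id (fvar x p) = refl
  bren-id (bvar i) = refl
  bren-id (lam t) = cong lam (trans (bren-cong bext-id t) (bren-id t))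
  bren-id (app t u) = cong₂ app (bren-id t) (bren-id u)

  infix 4 _≗ˢ_ _≈*_

  _≗ˢ_ : ∀ {Φ Ψ} → BSub Γ Φ Ψ → BSub Γ Φ Ψ → Set
  s ≗ˢ s' = ∀ {A} (i : A ∈ _) → s {A} i ≡ s' i

  bsext-cong : ∀ {Φ Ψ B} {s s' : BSub Γ Φ Ψ} → s ≗ˢ s' → bsext {B = B} s ≗ˢ bsext s'
  bsext-cong e (here refl) = refl
  bsext-cong e (there i) = cong (bren there) (e i)

  bsub-cong : ∀ {Φ Ψ A} {s s' : BSub Γ Φ Ψ} → s ≗ˢ s' → (t : Tm Γ Φ A) → bsub s t ≡ bsub s' t
  bsub-cong e (fvar x p) = refl
  bsub-cong e (bvar i) = e i
  bsub-cong e (lam t) = cong lam (bsub-cong (bsext-cong e) t)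
  bsub-cong e (app t u) = cong₂ app (bsub-cong e t) (bsub-cong e u)

  bsub-bren : ∀ {Φ Ψ Ω A} (s : BSub Γ Ψ Ω) (r : BRen Φ Ψ) (t : Tm Γ Φ A) →
    bsub s (bren r t) ≡ bsub (λ i → s (r i)) t
  bsub-bren s r (fvar x p) = refl
  bsub-bren s r (bvar i) = refl
  bsub-bren s r (lam t) = cong lam (trans (bsub-bren (bsext s) (bext r) t)
    (bsub-cong (λ { (here refl) → refl ; (there i) → refl }) t))
  bsub-bren s r (app t u) = cong₂ app (bsub-bren s r t) (bsub-bren s r u)

  bren-bsub : ∀ {Φ Ψ Ω A} (r : BRen Ψ Ω) (s : BSub Γ Φ Ψ) (t : Tm Γ Φ A) →
    bren r (bsub s t) ≡ bsub (λ i → bren r (s i)) t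
  bren-bsub r s (fvar x p) = refl
  bren-bsub r s (bvar i) = refl
  bren-bsub r s (lam t) = cong lam (trans (bren-bsub (bext r) (bsext s) t)
    (bsub-cong (λ { (here refl) → refl
                  ; (there i) → trans (bren-∘ (bext r) there (s i)) (sym (bren-∘ there r (s i))) }) t))
  bren-bsub r s (app t u) = cong₂ app (bren-bsub r s t) (bren-bsub r s u)

  bsub-bsub : ∀ {Φ Ψ Ω A} (s : BSub Γ Ψ Ω) (s' : BSub Γ Φ Ψ) (t : Tm Γ Φ A) →
    bsub s (bsub s' t) ≡ bsub (λ i → bsub s (s' i)) t
  bsub-bsub s s' (fvar x p) = refl
  bsub-bsub s s' (bvar i) = refl
  bsub-bsub s s' (lam t) = cong lam (trans (bsub-bsub (bsext s) (bsext s') t)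
    (bsub-cong (λ { (here refl) → refl
                  ; (there i) → trans (bsub-bren (bsext s) there (s' i)) (sym (bren-bsub there s (s' i))) }) t))
  bsub-bsub s s' (app t u) = cong₂ app (bsub-bsub s s' t) (bsub-bsub s s' u)

  bsub-bvar : ∀ {Φ Ψ A} (r : BRen Φ Ψ) (t : Tm Γ Φ A) → bsub (λ i → bvar (r i)) t ≡ bren r t
  bsub-bvar r (fvar x p) = refl
  bsub-bvar r (bvar i) = refl
  bsub-bvar r (lam t) =
    cong lam (trans (bsub-cong (λ { (here refl) → refl ; (there i) → refl }) t) (bsub-bvar (bext r) t))
  bsub-bvar r (app t u) = cong₂ app (bsub-bvar r t) (bsub-bvar r u)

  bsub-id : ∀ {Φ A} (t : Tm Γ Φ A) → bsub bvar t ≡ t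
  bsub-id t = trans (bsub-bvar idʳ t) (bren-id t)

  ≡⇒≈ : ∀ {Φ A} {t u : Tm Γ Φ A} → t ≡ u → t ≈ u
  ≡⇒≈ refl = ≈refl

  bren-≈ : ∀ {Φ Ψ A} (r : BRen Φ Ψ) {t u : Tm Γ Φ A} → t ≈ u → bren r t ≈ bren r u
  bren-≈ r ≈refl = ≈refl
  bren-≈ r (≈sym e) = ≈sym (bren-≈ r e)
  bren-≈ r (≈trans e e') = ≈trans (bren-≈ r e) (bren-≈ r e')
  bren-≈ r (≈lam e) = ≈lam (bren-≈ (bext r) e)
  bren-≈ r (≈app e e') = ≈app (bren-≈ r e) (bren-≈ r e')
  bren-≈ r (β t u) = ≈trans (β (bren (bext r) t) (bren r u)) (≡⇒≈ (trans (bsub-bren _ (bext r) t)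
    (trans (bsub-cong (λ { (here refl) → refl ; (there i) → refl }) t) (sym (bren-bsub r _ t)))))
  bren-≈ r (η t) = ≈trans (η (bren r t)) (≡⇒≈ (cong (λ z → lam (app z (bvar (here refl))))
    (trans (bren-∘ there r t) (sym (bren-∘ (bext r) there t)))))

  _≈*_ : ∀ {Φ As} → All (Tm Γ Φ) As → All (Tm Γ Φ) As → Set
  [] ≈* [] = ⊤
  (m ∷ ms) ≈* (n ∷ ns) = (m ≈ n) × (ms ≈* ns)

  apps-cong : ∀ {Φ As} {t t' : Tm Γ Φ (ar As)} {ms ns : All (Tm Γ Φ) As} →
    t ≈ t' → ms ≈* ns → apps t ms ≈ apps t' ns
  apps-cong {ms = []} {[]} d _ = d
  apps-cong {ms = _ ∷ _} {_ ∷ _} d (e , es) = apps-cong (≈app d e) es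

  bren-apps : ∀ {Φ Ψ As} (r : BRen Φ Ψ) (t : Tm Γ Φ (ar As)) (ms : All (Tm Γ Φ) As) →
    bren r (apps t ms) ≡ apps (bren r t) (All.map (bren r) ms)
  bren-apps r t [] = refl
  bren-apps r t (m ∷ ms) = bren-apps r (app t m) ms

HeadInjective : (L : List Var) (a b : Var) → Λ L (ty a) → Λ L (ty b) → Set
HeadInjective L a b s t = ∀ (Ms : All (Λ L) (dom (ty a))) (Ns : All (Λ L) (dom (ty b))) →
  apps s Ms ≈ apps t Ns → a ≡ b × ArgsEq Ms Ns

module NbE (Γ : List Var) where

  data Head (Φ : List Ty) : Ty → Set where
    hfv : (x : Var) → .(x ∈ Γ) → Head Φ (ty x)
    hbv : ∀ {A} → A ∈ Φ → Head Φ A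

  mutual
    data Nf (Φ : List Ty) : Ty → Set where
      lamN : ∀ {A Bs} → Nf (A ∷ Φ) (ar Bs) → Nf Φ (ar (A ∷ Bs))
      neN  : ∀ {As} → Head Φ (ar As) → Sp Φ As → Nf Φ o

    data Sp (Φ : List Ty) : List Ty → Set where
      []  : Sp Φ []
      _∷_ : ∀ {A As} → Nf Φ A → Sp Φ As → Sp Φ (A ∷ As)

  renH : ∀ {Φ Ψ A} → BRen Φ Ψ → Head Φ A → Head Ψ A
  renH r (hfv x p) = hfv x p
  renH r (hbv i) = hbv (r i)

  mutual
    renNf : ∀ {Φ Ψ A} → BRen Φ Ψ → Nf Φ A → Nf Ψ A
    renNf r (lamN n) = lamN (renNf (bext r) n)
    renNf r (neN h sp) = neN (renH r h) (renSp r sp)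

    renSp : ∀ {Φ Ψ As} → BRen Φ Ψ → Sp Φ As → Sp Ψ As
    renSp r [] = []
    renSp r (n ∷ sp) = renNf r n ∷ renSp r sp

  mutual
    renNf-cong : ∀ {Φ Ψ A} {r r' : BRen Φ Ψ} → r ≗ʳ r' → (n : Nf Φ A) → renNf r n ≡ renNf r' n
    renNf-cong e (lamN n) = cong lamN (renNf-cong (bext-cong e) n)
    renNf-cong e (neN (hfv x p) sp) = cong (neN (hfv x p)) (renSp-cong e sp)
    renNf-cong e (neN (hbv i) sp) = cong₂ (λ j → neN (hbv j)) (e i) (renSp-cong e sp)

    renSp-cong : ∀ {Φ Ψ As} {r r' : BRen Φ Ψ} → r ≗ʳ r' → (sp : Sp Φ As) → renSp r sp ≡ renSp r' sp
    renSp-cong e [] = refl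
    renSp-cong e (n ∷ sp) = cong₂ _∷_ (renNf-cong e n) (renSp-cong e sp)

  mutual
    renNf-∘ : ∀ {Φ Ψ Ω A} (r' : BRen Ψ Ω) (r : BRen Φ Ψ) (n : Nf Φ A) →
      renNf r' (renNf r n) ≡ renNf (r' ∘ʳ r) n
    renNf-∘ r' r (lamN n) = cong lamN (trans (renNf-∘ (bext r') (bext r) n) (renNf-cong (bext-∘ r' r) n))
    renNf-∘ r' r (neN (hfv x p) sp) = cong (neN (hfv x p)) (renSp-∘ r' r sp)
    renNf-∘ r' r (neN (hbv i) sp) = cong (neN (hbv (r' (r i)))) (renSp-∘ r' r sp)

    renSp-∘ : ∀ {Φ Ψ Ω As} (r' : BRen Ψ Ω) (r : BRen Φ Ψ) (sp : Sp Φ As) →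
      renSp r' (renSp r sp) ≡ renSp (r' ∘ʳ r) sp
    renSp-∘ r' r [] = refl
    renSp-∘ r' r (n ∷ sp) = cong₂ _∷_ (renNf-∘ r' r n) (renSp-∘ r' r sp)

  mutual
    renNf-id : ∀ {Φ A} (n : Nf Φ A) → renNf idʳ n ≡ n
    renNf-id (lamN n) = cong lamN (trans (renNf-cong bext-id n) (renNf-id n))
    renNf-id (neN (hfv x p) sp) = cong (neN (hfv x p)) (renSp-id sp)
    renNf-id (neN (hbv i) sp) = cong (neN (hbv i)) (renSp-id sp)

    renSp-id : ∀ {Φ As} (sp : Sp Φ As) → renSp idʳ sp ≡ sp
    renSp-id [] = refl
    renSp-id (n ∷ sp) = cong₂ _∷_ (renNf-id n) (renSp-id sp)

  -- The Kripke model: SemS As Φ interprets ar As over the bound context Φ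

  mutual
    SemT : Ty → List Ty → Set
    SemT (ar As) Φ = SemS As Φ

    SemS : List Ty → List Ty → Set
    SemS [] Φ = Nf Φ o
    SemS (A ∷ Bs) Φ = ∀ {Ψ} → BRen Φ Ψ → SemT A Ψ → SemS Bs Ψ

  renT : ∀ A {Φ Ψ} → BRen Φ Ψ → SemT A Φ → SemT A Ψ
  renS : ∀ As {Φ Ψ} → BRen Φ Ψ → SemS As Φ → SemS As Ψ
  renT (ar As) r v = renS As r v
  renS [] r v = renNf r v
  renS (A ∷ Bs) r f = λ r' a → f (r' ∘ʳ r) a

  -- what a neutral of type ar As does with a spine, in every extension of Φ
  Cont : List Ty → List Ty → Set
  Cont As Φ = ∀ {Ψ} → BRen Φ Ψ → Sp Ψ As → Nf Ψ o

  mutual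
    reifyT : ∀ A {Φ} → SemT A Φ → Nf Φ A
    reifyT (ar As) v = reifyS As v

    reifyS : ∀ As {Φ} → SemS As Φ → Nf Φ (ar As)
    reifyS [] v = v
    reifyS (ar As ∷ Bs) f = lamN (reifyS Bs (f there (reflectS As (λ r sp → neN (hbv (r (here refl))) sp))))

    reflectS : ∀ As {Φ} → Cont As Φ → SemS As Φ
    reflectS [] k = k idʳ []
    reflectS (A ∷ Bs) k = λ r a → reflectS Bs (λ r' sp → k (r' ∘ʳ r) (reifyT A (renT A r' a) ∷ sp))

  -- A partial equivalence relation singling out the uniform (natural) values

  mutual
    EqT : ∀ A {Φ} → SemT A Φ → SemT A Φ → Set
    EqT (ar As) v w = EqS As v w

    EqS : ∀ As {Φ} → SemS As Φ → SemS As Φ → Set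
    EqS [] v w = v ≡ w
    EqS (A ∷ Bs) {Φ} f g =
      (∀ {Ψ} (r : BRen Φ Ψ) {a b} → EqT A a b → EqS Bs (f r a) (g r b)) ×
      Uniform A Bs f × Uniform A Bs g

    Uniform : ∀ A Bs {Φ} → SemS (A ∷ Bs) Φ → Set
    Uniform A Bs {Φ} f = ∀ {Ψ Ω} (r : BRen Φ Ψ) (r' : BRen Ψ Ω) {a} → EqT A a a →
      EqS Bs (renS Bs r' (f r a)) (f (r' ∘ʳ r) (renT A r' a))

  symT : ∀ A {Φ} {v w : SemT A Φ} → EqT A v w → EqT A w v
  symS : ∀ As {Φ} {v w : SemS As Φ} → EqS As v w → EqS As w v
  symT (ar As) e = symS As e
  symS [] e = sym e
  symS (A ∷ Bs) (pw , u , u') = (λ r e → symS Bs (pw r (symT A e))) , u' , u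

  transT : ∀ A {Φ} {u v w : SemT A Φ} → EqT A u v → EqT A v w → EqT A u w
  transS : ∀ As {Φ} {u v w : SemS As Φ} → EqS As u v → EqS As v w → EqS As u w
  transT (ar As) e e' = transS As e e'
  transS [] e e' = trans e e'
  transS (A ∷ Bs) (pw , u , _) (pw' , _ , u') =
    (λ r e → transS Bs (pw r e) (pw' r (transT A (symT A e) e))) , u , u'

  reflˡT : ∀ A {Φ} {v w : SemT A Φ} → EqT A v w → EqT A v v
  reflˡT A e = transT A e (symT A e)

  reflʳT : ∀ A {Φ} {v w : SemT A Φ} → EqT A v w → EqT A w w
  reflʳT A e = transT A (symT A e) e

  renS-cong : ∀ As {Φ Ψ} (r : BRen Φ Ψ) {v w : SemS As Φ} → EqS As v w → EqS As (renS As r v) (renS As r w)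
  renS-cong [] r e = cong (renNf r) e
  renS-cong (A ∷ Bs) r (pw , u , u') =
    (λ r' e → pw (r' ∘ʳ r) e) , (λ r' r'' e → u (r' ∘ʳ r) r'' e) , (λ r' r'' e → u' (r' ∘ʳ r) r'' e)

  renT-cong : ∀ A {Φ Ψ} (r : BRen Φ Ψ) {v w : SemT A Φ} → EqT A v w → EqT A (renT A r v) (renT A r w)
  renT-cong (ar As) r e = renS-cong As r e

  renT-∘ : ∀ A {Φ Ψ Ω} (r' : BRen Ψ Ω) (r : BRen Φ Ψ) {v : SemT A Φ} → EqT A v v →
    EqT A (renT A r' (renT A r v)) (renT A (r' ∘ʳ r) v)
  renT-∘ (ar []) r' r {v} e = renNf-∘ r' r v
  renT-∘ (ar (A ∷ Bs)) r' r e = renS-cong (A ∷ Bs) (r' ∘ʳ r) e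

  renT-id : ∀ A {Φ} {v : SemT A Φ} → EqT A v v → EqT A (renT A idʳ v) v
  renT-id (ar []) {v = v} e = renNf-id v
  renT-id (ar (A ∷ Bs)) e = e

  Natural : ∀ As {Φ} → Cont As Φ → Set
  Natural As {Φ} k = ∀ {Ψ Ω} (r : BRen Φ Ψ) (r' : BRen Ψ Ω) (sp : Sp Ψ As) →
    renNf r' (k r sp) ≡ k (r' ∘ʳ r) (renSp r' sp)

  var₀ : ∀ As {Φ} → Cont As (ar As ∷ Φ)
  var₀ As r sp = neN (hbv (r (here refl))) sp

  var₀-natural : ∀ As {Φ} → Natural As {ar As ∷ Φ} (var₀ As)
  var₀-natural As r r' sp = refl

  mutual
    reifyS-cong : ∀ As {Φ} {v w : SemS As Φ} → EqS As v w → reifyS As v ≡ reifyS As w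
    reifyS-cong [] e = e
    reifyS-cong (ar As ∷ Bs) (pw , _ , _) =
      cong lamN (reifyS-cong Bs (pw there
        (reflectS-cong As (var₀ As) (var₀ As) (var₀-natural As) (var₀-natural As) (λ _ _ → refl))))

    reflectS-cong : ∀ As {Φ} (k k' : Cont As Φ) → Natural As k → Natural As k' →
      (∀ {Ψ} (r : BRen Φ Ψ) sp → k r sp ≡ k' r sp) → EqS As (reflectS As k) (reflectS As k')
    reflectS-cong [] k k' nk nk' e = e idʳ []
    reflectS-cong (ar As ∷ Bs) k k' nk nk' e =
      (λ r {a} {b} ea → reflectS-cong Bs _ _
          (applied-natural As Bs k nk r (reflˡT (ar As) ea))
          (applied-natural As Bs k' nk' r (reflʳT (ar As) ea))
          (λ r' sp → trans (e _ _) (cong (λ z → k' (r' ∘ʳ r) (z ∷ sp)) (reifyS-cong As (renS-cong As r' ea))))) ,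
      reflectS-uniform As Bs k nk , reflectS-uniform As Bs k' nk'

    applied-natural : ∀ As Bs {Φ} (k : Cont (ar As ∷ Bs) Φ) → Natural (ar As ∷ Bs) k →
      ∀ {Ψ} (r : BRen Φ Ψ) {a : SemS As Ψ} → EqS As a a →
      Natural Bs (λ r' sp → k (r' ∘ʳ r) (reifyS As (renS As r' a) ∷ sp))
    applied-natural As Bs k nk r ea r' r'' sp =
      trans (nk (r' ∘ʳ r) r'' _) (cong (λ z → k ((r'' ∘ʳ r') ∘ʳ r) (z ∷ renSp r'' sp))
        (trans (renNf-reifyS As r'' (renS-cong As r' ea)) (reifyS-cong As (renT-∘ (ar As) r'' r' ea))))

    reflectS-uniform : ∀ As Bs {Φ} (k : Cont (ar As ∷ Bs) Φ) → Natural (ar As ∷ Bs) k →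
      Uniform (ar As) Bs (reflectS (ar As ∷ Bs) k)
    reflectS-uniform As Bs k nk r r' ea =
      transS Bs (renS-reflectS Bs r' _ (applied-natural As Bs k nk r ea))
        (reflectS-cong Bs _ _ (λ r'' r''' sp → applied-natural As Bs k nk r ea (r'' ∘ʳ r') r''' sp)
           (applied-natural As Bs k nk (r' ∘ʳ r) (renS-cong As r' ea))
           (λ r'' sp → cong (λ z → k ((r'' ∘ʳ r') ∘ʳ r) (z ∷ sp))
                             (sym (reifyS-cong As (renT-∘ (ar As) r'' r' ea)))))

    renS-reflectS : ∀ As {Φ Ψ} (r : BRen Φ Ψ) (k : Cont As Φ) → Natural As k →
      EqS As (renS As r (reflectS As k)) (reflectS As (λ r' → k (r' ∘ʳ r)))
    renS-reflectS [] r k nk = nk idʳ r []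
    renS-reflectS (A ∷ Bs) r k nk =
      reflectS-cong (A ∷ Bs) (λ r' → k (r' ∘ʳ r)) (λ r' → k (r' ∘ʳ r))
        (λ r' r'' sp → nk (r' ∘ʳ r) r'' sp) (λ r' r'' sp → nk (r' ∘ʳ r) r'' sp) (λ _ _ → refl)

    renNf-reifyS : ∀ As {Φ Ψ} (r : BRen Φ Ψ) {v : SemS As Φ} → EqS As v v →
      renNf r (reifyS As v) ≡ reifyS As (renS As r v)
    renNf-reifyS [] r e = refl
    renNf-reifyS (ar As ∷ Bs) r (pw , u , _) =
      cong lamN (trans (renNf-reifyS Bs (bext r) (pw there v₀))
        (reifyS-cong Bs (transS Bs (u there (bext r) v₀)
          (pw (λ i → there (r i)) (renS-reflectS As (bext r) (var₀ As) (var₀-natural As))))))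
      where
      v₀ : EqS As (reflectS As (var₀ As)) (reflectS As (var₀ As))
      v₀ = reflectS-cong As (var₀ As) (var₀ As) (var₀-natural As) (var₀-natural As) (λ _ _ → refl)

  reifyT-cong : ∀ A {Φ} {v w : SemT A Φ} → EqT A v w → reifyT A v ≡ reifyT A w
  reifyT-cong (ar As) e = reifyS-cong As e

  Env : List Ty → List Ty → Set
  Env Φ Ψ = ∀ {A} → A ∈ Φ → SemT A Ψ

  ∅ : ∀ {Ψ} → Env [] Ψ
  ∅ ()

  extend : ∀ {Φ Ψ} A → Env Φ Ψ → SemT A Ψ → Env (A ∷ Φ) Ψ
  extend A γ a (here refl) = a
  extend A γ a (there i) = γ i

  renEnv : ∀ {Φ Ψ Ω} → BRen Ψ Ω → Env Φ Ψ → Env Φ Ω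
  renEnv r γ {A} i = renT A r (γ i)

  EqE : ∀ {Φ Ψ} → Env Φ Ψ → Env Φ Ψ → Set
  EqE {Φ} γ γ' = ∀ {A} (i : A ∈ Φ) → EqT A (γ i) (γ' i)

  extend-cong : ∀ {Φ Ψ} A {γ γ' : Env Φ Ψ} {a b : SemT A Ψ} →
    EqE γ γ' → EqT A a b → EqE (extend A γ a) (extend A γ' b)
  extend-cong A e ea (here refl) = ea
  extend-cong A e ea (there i) = e i

  renEnv-cong : ∀ {Φ Ψ Ω} (r : BRen Ψ Ω) {γ γ' : Env Φ Ψ} → EqE γ γ' → EqE (renEnv r γ) (renEnv r γ')
  renEnv-cong r e {A} i = renT-cong A r (e i)

  symE : ∀ {Φ Ψ} {γ γ' : Env Φ Ψ} → EqE γ γ' → EqE γ' γ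
  symE e {A} i = symT A (e i)

  reflˡE : ∀ {Φ Ψ} {γ γ' : Env Φ Ψ} → EqE γ γ' → EqE γ γ
  reflˡE e {A} i = reflˡT A (e i)

  reflʳE : ∀ {Φ Ψ} {γ γ' : Env Φ Ψ} → EqE γ γ' → EqE γ' γ'
  reflʳE e {A} i = reflʳT A (e i)

  eval : ∀ {Φ Ψ A} → Tm Γ Φ A → Env Φ Ψ → SemT A Ψ
  eval (fvar (n ^ ar As) p) γ = reflectS As (λ _ sp → neN (hfv (n ^ ar As) p) sp)
  eval (bvar i) γ = γ i
  eval (lam {A} t) γ = λ r a → eval t (extend A (renEnv r γ) a)
  eval (app t u) γ = eval t γ idʳ (eval u γ)

  eval-fvar-cong : ∀ {Φ Ψ Ψ'} (x : Var) .(p : x ∈ Γ) {γ : Env Φ Ψ'} {γ' : Env Ψ Ψ'} →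
    EqT (ty x) (eval (fvar x p) γ) (eval (fvar x p) γ')
  eval-fvar-cong (n ^ ar As) p = reflectS-cong As _ _ (λ _ _ _ → refl) (λ _ _ _ → refl) (λ _ _ → refl)

  mutual
    eval-cong : ∀ {Φ Ψ A} (t : Tm Γ Φ A) {γ γ' : Env Φ Ψ} → EqE γ γ' → EqT A (eval t γ) (eval t γ')
    eval-cong (fvar x p) e = eval-fvar-cong x p
    eval-cong (bvar i) e = e i
    eval-cong (lam {A} t) {γ} {γ'} e =
      (λ r ea → eval-cong t (extend-cong A (renEnv-cong r e) ea)) ,
      eval-lam-uniform t γ (reflˡE e) , eval-lam-uniform t γ' (reflʳE e)
    eval-cong (app t u) e = proj₁ (eval-cong t e) idʳ (eval-cong u e)

    eval-lam-uniform : ∀ {Φ Ψ A Bs} (t : Tm Γ (A ∷ Φ) (ar Bs)) (γ : Env Φ Ψ) → EqE γ γ →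
      Uniform A Bs (eval (lam t) γ)
    eval-lam-uniform {A = A} {Bs} t γ eγ r r' ea =
      transS Bs (renT-eval t r' (extend-cong A (renEnv-cong r eγ) ea))
        (eval-cong t (λ {B} → λ { (here refl) → renT-cong A r' ea ; (there i) → renT-∘ B r' r (eγ i) }))

    renT-eval : ∀ {Φ Ψ Ω A} (t : Tm Γ Φ A) (r : BRen Ψ Ω) {γ : Env Φ Ψ} → EqE γ γ →
      EqT A (renT A r (eval t γ)) (eval t (renEnv r γ))
    renT-eval (fvar (n ^ ar As) p) r e = renS-reflectS As r _ (λ _ _ _ → refl)
    renT-eval {A = A} (bvar i) r e = renT-cong A r (e i)
    renT-eval (lam {A} t) r {γ} e =
      (λ r' ea → eval-cong t (extend-cong A (λ {B} i → symT B (renT-∘ B r' r (e i))) ea)) ,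
      (λ r₁ r₂ ea → eval-lam-uniform t γ e (r₁ ∘ʳ r) r₂ ea) ,
      eval-lam-uniform t (renEnv r γ) (renEnv-cong r e)
    renT-eval (app {A} {Bs} t u) r e =
      transS Bs (proj₁ (proj₂ (eval-cong t e)) idʳ r (eval-cong u e))
        (proj₁ (renT-eval t r e) idʳ (renT-eval u r e))

  eval-bren : ∀ {Φ Φ' Ψ A} (t : Tm Γ Φ A) (r : BRen Φ Φ') {γ γ' : Env Φ' Ψ} → EqE γ γ' →
    EqT A (eval (bren r t) γ) (eval t (λ i → γ' (r i)))
  eval-bren (fvar x p) r e = eval-fvar-cong x p
  eval-bren (bvar i) r e = e (r i)
  eval-bren (app t u) r e = proj₁ (eval-bren t r e) idʳ (eval-bren u r e)
  eval-bren (lam {A} {Bs} t) r {γ} {γ'} e =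
    (λ r' ea → transS Bs (eval-bren t (bext r) (extend-cong A (renEnv-cong r' e) ea))
       (eval-cong t (λ {B} → λ { (here refl) → reflʳT A ea ; (there i) → renT-cong B r' (reflʳE e (r i)) }))) ,
    eval-lam-uniform (bren (bext r) t) γ (reflˡE e) ,
    eval-lam-uniform t (λ i → γ' (r i)) (λ i → reflʳE e (r i))

  eval-bsub : ∀ {Φ Φ' Ψ A} (t : Tm Γ Φ A) (s : BSub Γ Φ Φ') {γ γ' : Env Φ' Ψ} → EqE γ γ' →
    EqT A (eval (bsub s t) γ) (eval t (λ i → eval (s i) γ'))
  eval-bsub (fvar x p) s e = eval-fvar-cong x p
  eval-bsub (bvar i) s e = eval-cong (s i) e
  eval-bsub (app t u) s e = proj₁ (eval-bsub t s e) idʳ (eval-bsub u s e)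
  eval-bsub (lam {A} {Bs} t) s {γ} {γ'} e =
    (λ r' ea → transS Bs (eval-bsub t (bsext s) (extend-cong A (renEnv-cong r' e) ea))
       (eval-cong t (λ {B} → λ { (here refl) → reflʳT A ea
         ; (there i) → transT B (eval-bren (s i) there (extend-cong A (renEnv-cong r' (reflʳE e)) (reflʳT A ea)))
                                (symT B (renT-eval (s i) r' (reflʳE e))) }))) ,
    eval-lam-uniform (bsub (bsext s) t) γ (reflˡE e) ,
    eval-lam-uniform t (λ i → eval (s i) γ') (λ i → eval-cong (s i) (reflʳE e))

  eval-≈ : ∀ {Φ Ψ A} {t u : Tm Γ Φ A} → t ≈ u → {γ γ' : Env Φ Ψ} → EqE γ γ' →
    EqT A (eval t γ) (eval u γ')
  eval-≈ {t = t} ≈refl e = eval-cong t e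
  eval-≈ {A = A} (≈sym d) e = symT A (eval-≈ d (symE e))
  eval-≈ {A = A} (≈trans d d') e = transT A (eval-≈ d e) (eval-≈ d' (reflʳE e))
  eval-≈ (≈lam {A = A} {t = t} {u} d) {γ} {γ'} e =
    (λ r ea → eval-≈ d (extend-cong A (renEnv-cong r e) ea)) ,
    eval-lam-uniform t γ (reflˡE e) , eval-lam-uniform u γ' (reflʳE e)
  eval-≈ (≈app d d') e = proj₁ (eval-≈ d e) idʳ (eval-≈ d' e)
  eval-≈ (β {A = A} {Bs} t u) e =
    transS Bs (eval-cong t (λ {B} → λ { (here refl) → eval-cong u e
                                      ; (there i) → transT B (renT-id B (reflˡE e i)) (e i) }))
      (symS Bs (eval-bsub t (single u) (reflʳE e)))
  eval-≈ (η {A = A} {Bs} t) {γ} {γ'} e =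
    (λ r ea → transS Bs (proj₁ ft r ea) (symS Bs
       (transS Bs (proj₁ (eval-bren t there (extend-cong A (renEnv-cong r (reflʳE e)) (reflʳT A ea))) idʳ (reflʳT A ea))
                  (proj₁ (symS (A ∷ Bs) (renT-eval t r (reflʳE e))) idʳ (reflʳT A ea))))) ,
    proj₁ (proj₂ ft) ,
    eval-lam-uniform (app (bren there t) (bvar (here refl))) γ' (reflʳE e)
    where
    ft : EqS (A ∷ Bs) (eval t γ) (eval t γ')
    ft = eval-cong t e

  -- Soundness, by a logical relation between terms and semantic values

  embH : ∀ {Φ A} → Head Φ A → Tm Γ Φ A
  embH (hfv x p) = fvar x p
  embH (hbv i) = bvar i

  mutual
    emb : ∀ {Φ A} → Nf Φ A → Tm Γ Φ A
    emb (lamN n) = lam (emb n)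
    emb (neN h sp) = apps (embH h) (embSp sp)

    embSp : ∀ {Φ As} → Sp Φ As → All (Tm Γ Φ) As
    embSp [] = []
    embSp (n ∷ sp) = emb n ∷ embSp sp

  mutual
    bren-emb : ∀ {Φ Ψ A} (r : BRen Φ Ψ) (n : Nf Φ A) → bren r (emb n) ≡ emb (renNf r n)
    bren-emb r (lamN n) = cong lam (bren-emb (bext r) n)
    bren-emb r (neN (hfv x p) sp) =
      trans (bren-apps r (fvar x p) (embSp sp)) (cong (apps (fvar x p)) (bren-embSp r sp))
    bren-emb r (neN (hbv i) sp) =
      trans (bren-apps r (bvar i) (embSp sp)) (cong (apps (bvar (r i))) (bren-embSp r sp))

    bren-embSp : ∀ {Φ Ψ As} (r : BRen Φ Ψ) (sp : Sp Φ As) → All.map (bren r) (embSp sp) ≡ embSp (renSp r sp)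
    bren-embSp r [] = refl
    bren-embSp r (n ∷ sp) = cong₂ _∷_ (bren-emb r n) (bren-embSp r sp)

  Rel : ∀ As {Φ} → Tm Γ Φ (ar As) → SemS As Φ → Set
  Rel [] t v = t ≈ emb v
  Rel (ar As ∷ Bs) {Φ} t f = ∀ {Ψ} (r : BRen Φ Ψ) (u : Tm Γ Ψ (ar As)) (a : SemS As Ψ) → Rel As u a →
    Rel Bs (app (bren r t) u) (f r a)

  RelT : ∀ A {Φ} → Tm Γ Φ A → SemT A Φ → Set
  RelT (ar As) t v = Rel As t v

  Rel-≈ : ∀ As {Φ} {t t' : Tm Γ Φ (ar As)} {v} → t ≈ t' → Rel As t v → Rel As t' v
  Rel-≈ [] d h = ≈trans (≈sym d) h
  Rel-≈ (ar As ∷ Bs) d h r u a hu = Rel-≈ Bs (≈app (bren-≈ r d) ≈refl) (h r u a hu)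

  Rel-bren : ∀ As {Φ Ψ} (r : BRen Φ Ψ) {t : Tm Γ Φ (ar As)} {v} → Rel As t v → Rel As (bren r t) (renS As r v)
  Rel-bren [] r {t} {v} h = ≈trans (bren-≈ r h) (≡⇒≈ (bren-emb r v))
  Rel-bren (ar As ∷ Bs) r {t} h r' u a hu =
    Rel-≈ Bs (≈app (≡⇒≈ (sym (bren-∘ r' r t))) ≈refl) (h (r' ∘ʳ r) u a hu)

  RelT-bren : ∀ A {Φ Ψ} (r : BRen Φ Ψ) {t : Tm Γ Φ A} {v} → RelT A t v → RelT A (bren r t) (renT A r v)
  RelT-bren (ar As) r h = Rel-bren As r h

  mutual
    reifyS-sound : ∀ As {Φ} {t : Tm Γ Φ (ar As)} {v} → Rel As t v → t ≈ emb (reifyS As v)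
    reifyS-sound [] h = h
    reifyS-sound (ar As ∷ Bs) {t = t} h =
      ≈trans (η t) (≈lam (reifyS-sound Bs (h there (bvar (here refl)) _
        (reflectS-sound As (bvar (here refl)) (var₀ As) (λ r ms sp es → apps-cong ≈refl es)))))

    reflectS-sound : ∀ As {Φ} (t : Tm Γ Φ (ar As)) (k : Cont As Φ) →
      (∀ {Ψ} (r : BRen Φ Ψ) ms sp → ms ≈* embSp sp → apps (bren r t) ms ≈ emb (k r sp)) →
      Rel As t (reflectS As k)
    reflectS-sound [] t k H = ≈trans (≡⇒≈ (sym (bren-id t))) (H idʳ [] [] tt)
    reflectS-sound (ar As ∷ Bs) t k H r u a hu =
      reflectS-sound Bs (app (bren r t) u) _ (λ r' ms sp es →
        ≈trans (≡⇒≈ (cong (λ z → apps (app z (bren r' u)) ms) (bren-∘ r' r t)))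
          (H (r' ∘ʳ r) (bren r' u ∷ ms) (_ ∷ sp) (reifyS-sound As (Rel-bren As r' hu) , es)))

  fundamental : ∀ {Φ Ψ A} (t : Tm Γ Φ A) (s : BSub Γ Φ Ψ) (γ : Env Φ Ψ) →
    (∀ {B} (i : B ∈ Φ) → RelT B (s i) (γ i)) → RelT A (bsub s t) (eval t γ)
  fundamental (fvar (n ^ ar As) p) s γ h =
    reflectS-sound As (fvar (n ^ ar As) p) _ (λ r ms sp es → apps-cong ≈refl es)
  fundamental (bvar i) s γ h = h i
  fundamental (app {ar As} {Bs} t u) s γ h =
    Rel-≈ Bs (≈app (≡⇒≈ (bren-id (bsub s t))) ≈refl)
      (fundamental t s γ h idʳ (bsub s u) (eval u γ) (fundamental u s γ h))
  fundamental (lam {ar As} {Bs} t) s γ h r u a hu =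
    Rel-≈ Bs (≈sym (≈trans (β _ u) (≡⇒≈ β-reduct)))
      (fundamental t s' (extend (ar As) (renEnv r γ) a)
        (λ {B} → λ { (here refl) → hu ; (there i) → RelT-bren B r (h i) }))
    where
    s' : BSub Γ (ar As ∷ _) _
    s' (here refl) = u
    s' (there i) = bren r (s i)
    β-reduct : bsub (single u) (bren (bext r) (bsub (bsext s) t)) ≡ bsub s' t
    β-reduct = trans (bsub-bren (single u) (bext r) (bsub (bsext s) t))
      (trans (bsub-bsub _ (bsext s) t)
        (bsub-cong (λ { (here refl) → refl
                      ; (there i) → trans (bsub-bren _ there (s i)) (bsub-bvar r (s i)) }) t))

  nf : ∀ {A} → Tm Γ [] A → Nf [] A
  nf {A} t = reifyT A (eval t ∅)

  nf-sound : ∀ {A} (t : Tm Γ [] A) → t ≈ emb (nf t)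
  nf-sound {ar As} t = ≈trans (≡⇒≈ (sym (bsub-id t))) (reifyS-sound As (fundamental t bvar ∅ (λ ())))

  nf-complete : ∀ {A} {t u : Tm Γ [] A} → t ≈ u → nf t ≡ nf u
  nf-complete {ar As} d = reifyS-cong As (eval-≈ d (λ ()))

  nf* : ∀ {As} → All (Tm Γ []) As → Sp [] As
  nf* [] = []
  nf* (m ∷ ms) = nf m ∷ nf* ms

  SemArgs : List Ty → List Ty → Set
  SemArgs As Φ = All (λ A → SemT A Φ) As

  evalArgs : ∀ {Φ Ψ As} → All (Tm Γ Φ) As → Env Φ Ψ → SemArgs As Ψ
  evalArgs [] γ = []
  evalArgs (m ∷ ms) γ = eval m γ ∷ evalArgs ms γ

  SelfEqArgs : ∀ {As Φ} → SemArgs As Φ → Set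
  SelfEqArgs [] = ⊤
  SelfEqArgs {A ∷ _} (a ∷ as) = EqT A a a × SelfEqArgs as

  reifyArgs : ∀ {As Φ} → SemArgs As Φ → Sp Φ As
  reifyArgs [] = []
  reifyArgs {A ∷ _} (a ∷ as) = reifyT A a ∷ reifyArgs as

  appS : ∀ As {Φ} → SemS As Φ → SemArgs As Φ → Nf Φ o
  appS [] v [] = v
  appS (A ∷ Bs) f (a ∷ as) = appS Bs (f idʳ a) as

  eval-apps : ∀ {Φ Ψ As} (t : Tm Γ Φ (ar As)) (ms : All (Tm Γ Φ) As) (γ : Env Φ Ψ) →
    eval (apps t ms) γ ≡ appS As (eval t γ) (evalArgs ms γ)
  eval-apps t [] γ = refl
  eval-apps t (m ∷ ms) γ = eval-apps (app t m) ms γ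

  appS-reflectS : ∀ As {Φ} (k : Cont As Φ) (as : SemArgs As Φ) → SelfEqArgs as →
    appS As (reflectS As k) as ≡ k idʳ (reifyArgs as)
  appS-reflectS [] k [] _ = refl
  appS-reflectS (A ∷ Bs) k (a ∷ as) (ea , eas) =
    trans (appS-reflectS Bs _ as eas) (cong (λ z → k idʳ (z ∷ reifyArgs as)) (reifyT-cong A (renT-id A ea)))

  nf-apps-fvar : ∀ n As .(p : (n ^ ar As) ∈ Γ) (ms : All (Tm Γ []) As) →
    nf (apps (fvar (n ^ ar As) p) ms) ≡ neN (hfv (n ^ ar As) p) (nf* ms)
  nf-apps-fvar n As p ms =
    trans (eval-apps (fvar (n ^ ar As) p) ms ∅)
      (trans (appS-reflectS As _ (evalArgs ms ∅) (self-eq ms)) (cong (neN (hfv (n ^ ar As) p)) (reify-eval ms)))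
    where
    reify-eval : ∀ {As} (ms : All (Tm Γ []) As) → reifyArgs (evalArgs ms ∅) ≡ nf* ms
    reify-eval [] = refl
    reify-eval (m ∷ ms) = cong (nf m ∷_) (reify-eval ms)
    self-eq : ∀ {As} (ms : All (Tm Γ []) As) → SelfEqArgs (evalArgs ms (∅ {[]}))
    self-eq [] = tt
    self-eq (m ∷ ms) = eval-cong m (λ ()) , self-eq ms

  SpineEq : ∀ {n m As Bs} → (n ^ ar As) ≡ (m ^ ar Bs) → Sp [] As → Sp [] Bs → Set
  SpineEq refl sp sp' = sp ≡ sp'

  neN-hfv-injective : ∀ {n m As Bs} .{p : (n ^ ar As) ∈ Γ} .{q : (m ^ ar Bs) ∈ Γ} {sp : Sp [] As} {sp' : Sp [] Bs} →
    neN (hfv (n ^ ar As) p) sp ≡ neN (hfv (m ^ ar Bs) q) sp' →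
    Σ ((n ^ ar As) ≡ (m ^ ar Bs)) (λ e → SpineEq e sp sp')
  neN-hfv-injective refl = refl , refl

  ∷-injective : ∀ {Φ A As} {x y : Nf Φ A} {xs ys : Sp Φ As} → x ∷ xs ≡ y ∷ ys → x ≡ y × xs ≡ ys
  ∷-injective refl = refl , refl

  nf*-injective : ∀ {As} (ms ns : All (Tm Γ []) As) → nf* ms ≡ nf* ns → ArgsEq ms ns
  nf*-injective [] [] e = []
  nf*-injective (m ∷ ms) (n ∷ ns) e with ∷-injective e
  ... | e₁ , e₂ = ≈trans (nf-sound m) (≈trans (≡⇒≈ (cong emb e₁)) (≈sym (nf-sound n))) ∷ nf*-injective ms ns e₂

  fvar-head-injective : ∀ a b .(pa : a ∈ Γ) .(pb : b ∈ Γ) → HeadInjective Γ a b (fvar a pa) (fvar b pb)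
  fvar-head-injective (n ^ ar As) (m ^ ar Bs) pa pb Ms Ns d
    with neN-hfv-injective (trans (sym (nf-apps-fvar n As pa Ms))
                             (trans (nf-complete d) (nf-apps-fvar m Bs pb Ns)))
  ... | refl , e = refl , nf*-injective Ms Ns e

open NbE using (fvar-head-injective)

∈-++⁻ʳ : ∀ {c : Var} Ξ {L} → c ∈ Ξ ++ L → ¬ c ∈ Ξ → c ∈ L
∈-++⁻ʳ Ξ p c∉Ξ with ∈-++⁻ Ξ p
... | inj₁ c∈Ξ = ⊥-elim (c∉Ξ c∈Ξ)
... | inj₂ c∈L = c∈L

^ext-∈ : ∀ {Γ Δ} (ρ : Subst Γ Δ) Ξ c .(p : c ∈ Ξ ++ Γ) (c∈Ξ : c ∈ Ξ) →
  (ρ ^ext Ξ) c p ≡ fvar c (∈-++⁺ˡ c∈Ξ)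
^ext-∈ ρ Ξ c p c∈Ξ with c ∈? Ξ
... | yes _ = refl
... | no c∉Ξ = ⊥-elim (c∉Ξ c∈Ξ)

^ext-∉ : ∀ {Γ Δ} (ρ : Subst Γ Δ) Ξ c .(p : c ∈ Ξ ++ Γ) (c∉Ξ : ¬ c ∈ Ξ) →
  (ρ ^ext Ξ) c p ≡ fren (∈-++⁺ʳ Ξ) (ρ c (∈-++⁻ʳ Ξ p c∉Ξ))
^ext-∉ ρ Ξ c p c∉Ξ with c ∈? Ξ
... | yes c∈Ξ = ⊥-elim (c∉Ξ c∈Ξ)
... | no _ = refl

fren-irrelevant : ∀ {Γ Δ Φ A} (r r' : ∀ {x} → x ∈ Γ → x ∈ Δ) (t : Tm Γ Φ A) → fren r t ≡ fren r' t
fren-irrelevant r r' (fvar x p) = refl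
fren-irrelevant r r' (bvar i) = refl
fren-irrelevant r r' (lam t) = cong lam (fren-irrelevant r r' t)
fren-irrelevant r r' (app t u) = cong₂ app (fren-irrelevant r r' t) (fren-irrelevant r r' u)

fren-∘ : ∀ {Γ Δ Θ Φ A} (r : ∀ {x} → x ∈ Δ → x ∈ Θ) (r' : ∀ {x} → x ∈ Γ → x ∈ Δ) (t : Tm Γ Φ A) →
  fren r (fren r' t) ≡ fren (λ p → r (r' p)) t
fren-∘ r r' (fvar x p) = refl
fren-∘ r r' (bvar i) = refl
fren-∘ r r' (lam t) = cong lam (fren-∘ r r' t)
fren-∘ r r' (app t u) = cong₂ app (fren-∘ r r' t) (fren-∘ r r' u)

subst-fvar : ∀ {L₁ L₂} (e : L₁ ≡ L₂) c .{p : c ∈ L₁} .{q : c ∈ L₂} →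
  subst (λ L → Λ L (ty c)) e (fvar c p) ≡ fvar c q
subst-fvar refl c = refl

subst-fren : ∀ {Γ L₁ L₂ A} (e : L₁ ≡ L₂) (r : ∀ {x} → x ∈ Γ → x ∈ L₁) (r' : ∀ {x} → x ∈ Γ → x ∈ L₂)
  (t : Λ Γ A) → subst (λ L → Λ L A) e (fren r t) ≡ fren r' t
subst-fren refl r r' t = fren-irrelevant r r' t

^ext-++ : ∀ {Γ Δ} (ρ : Subst Γ Δ) Θ Ξ c (p : c ∈ (Ξ ++ Θ) ++ Γ) (q : c ∈ Ξ ++ (Θ ++ Γ)) →
  subst (λ L → Λ L (ty c)) (++-assoc Ξ Θ Δ) ((ρ ^ext (Ξ ++ Θ)) c p) ≡ ((ρ ^ext Θ) ^ext Ξ) c q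
^ext-++ {Γ} {Δ} ρ Θ Ξ c p q = by-cases (c ∈? Ξ) (c ∈? Θ)
  where
  open ≡-Reasoning
  P : List Var → Set
  P L = Λ L (ty c)

  assoc : (Ξ ++ Θ) ++ Δ ≡ Ξ ++ (Θ ++ Δ)
  assoc = ++-assoc Ξ Θ Δ

  q' : ¬ c ∈ Ξ → c ∈ Θ ++ Γ
  q' = ∈-++⁻ʳ Ξ q

  by-cases : Dec (c ∈ Ξ) → Dec (c ∈ Θ) → subst P assoc ((ρ ^ext (Ξ ++ Θ)) c p) ≡ ((ρ ^ext Θ) ^ext Ξ) c q
  by-cases (yes c∈Ξ) _ = begin
    subst P assoc ((ρ ^ext (Ξ ++ Θ)) c p)  ≡⟨ cong (subst P assoc) (^ext-∈ ρ (Ξ ++ Θ) c p (∈-++⁺ˡ c∈Ξ)) ⟩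
    subst P assoc (fvar c _)               ≡⟨ subst-fvar assoc c ⟩
    fvar c (∈-++⁺ˡ c∈Ξ)                    ≡⟨ sym (^ext-∈ (ρ ^ext Θ) Ξ c q c∈Ξ) ⟩
    ((ρ ^ext Θ) ^ext Ξ) c q                ∎
  by-cases (no c∉Ξ) (yes c∈Θ) = begin
    subst P assoc ((ρ ^ext (Ξ ++ Θ)) c p)   ≡⟨ cong (subst P assoc) (^ext-∈ ρ (Ξ ++ Θ) c p (∈-++⁺ʳ Ξ c∈Θ)) ⟩
    subst P assoc (fvar c _)                ≡⟨ subst-fvar assoc c ⟩
    fren (∈-++⁺ʳ Ξ) (fvar c (∈-++⁺ˡ c∈Θ))   ≡⟨ cong (fren (∈-++⁺ʳ Ξ)) (sym (^ext-∈ ρ Θ c _ c∈Θ)) ⟩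
    fren (∈-++⁺ʳ Ξ) ((ρ ^ext Θ) c (q' c∉Ξ)) ≡⟨ sym (^ext-∉ (ρ ^ext Θ) Ξ c q c∉Ξ) ⟩
    ((ρ ^ext Θ) ^ext Ξ) c q                 ∎
  by-cases (no c∉Ξ) (no c∉Θ) = begin
    subst P assoc ((ρ ^ext (Ξ ++ Θ)) c p)       ≡⟨ cong (subst P assoc) (^ext-∉ ρ (Ξ ++ Θ) c p c∉Ξ++Θ) ⟩
    subst P assoc (fren (∈-++⁺ʳ (Ξ ++ Θ)) ρc)   ≡⟨ subst-fren assoc _ _ ρc ⟩
    fren (λ x → ∈-++⁺ʳ Ξ (∈-++⁺ʳ Θ x)) ρc       ≡⟨ sym (fren-∘ (∈-++⁺ʳ Ξ) (∈-++⁺ʳ Θ) ρc) ⟩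
    fren (∈-++⁺ʳ Ξ) (fren (∈-++⁺ʳ Θ) ρc)        ≡⟨ cong (fren (∈-++⁺ʳ Ξ)) (sym (^ext-∉ ρ Θ c _ c∉Θ)) ⟩
    fren (∈-++⁺ʳ Ξ) ((ρ ^ext Θ) c (q' c∉Ξ))     ≡⟨ sym (^ext-∉ (ρ ^ext Θ) Ξ c q c∉Ξ) ⟩
    ((ρ ^ext Θ) ^ext Ξ) c q                     ∎
    where
    c∉Ξ++Θ : ¬ c ∈ Ξ ++ Θ
    c∉Ξ++Θ c∈Ξ++Θ with ∈-++⁻ Ξ c∈Ξ++Θ
    ... | inj₁ c∈Ξ = c∉Ξ c∈Ξ
    ... | inj₂ c∈Θ = c∉Θ c∈Θ
    ρc : Λ Δ (ty c)
    ρc = ρ c (∈-++⁻ʳ Θ (q' c∉Ξ) c∉Θ)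

HeadInjective-transport : ∀ {L₁ L₂ a b} (e : L₁ ≡ L₂) {s t s' t'} →
  subst (λ L → Λ L (ty a)) e s ≡ s' → subst (λ L → Λ L (ty b)) e t ≡ t' →
  HeadInjective L₁ a b s t → HeadInjective L₂ a b s' t'
HeadInjective-transport refl refl refl h = h

Disjoint-++ˡ : ∀ {Ξ Θ L : List Var} → Disjoint Ξ (Θ ++ L) → Disjoint Θ L → Disjoint (Ξ ++ Θ) L
Disjoint-++ˡ {Ξ} dΞ dΘ (x∈Ξ++Θ , x∈L) with ∈-++⁻ Ξ x∈Ξ++Θ
... | inj₁ x∈Ξ = dΞ (x∈Ξ , ∈-++⁺ʳ _ x∈L)
... | inj₂ x∈Θ = dΘ (x∈Θ , x∈L)

Fresh-++ : ∀ {Ξ Θ Γ Δ} → Unique Θ → Disjoint Θ Γ → Disjoint Θ Δ →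
  Fresh Ξ (Θ ++ Γ) (Θ ++ Δ) → Fresh (Ξ ++ Θ) Γ Δ
Fresh-++ uΘ dΘΓ dΘΔ (uΞ , dΞΘΓ , dΞΘΔ) =
  ++⁺ uΞ uΘ (λ (x∈Ξ , x∈Θ) → dΞΘΓ (x∈Ξ , ∈-++⁺ˡ x∈Θ)) , Disjoint-++ˡ dΞΘΓ dΘΓ , Disjoint-++ˡ dΞΘΔ dΘΔ

⊆⇒≤ᵃ : ∀ {Γ Δ} → Γ ⊆ Δ → Γ ≤ᵃ Δ
⊆⇒≤ᵃ {Γ} {Δ} Γ⊆Δ = mk≤ᵃ ι atomic
  where
  ι : Subst Γ Δ
  ι c p = fvar c (Γ⊆Δ p)

  ι^ext : ∀ Ξ c (p : c ∈ Ξ ++ Γ) → (ι ^ext Ξ) c p ≡ fvar c (++⁺ʳ Ξ Γ⊆Δ p)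
  ι^ext Ξ c p with c ∈? Ξ
  ... | yes _ = refl
  ... | no _ = refl

  -- ι^Ξ is again an inclusion
  atomic : IsAtomicReduction Γ Δ ι
  atomic Ξ _ a b pa pb Ms Ns d =
    fvar-head-injective (Ξ ++ Δ) a b _ _ Ms Ns
      (subst₂ (λ s t → apps s Ms ≈ apps t Ns) (ι^ext Ξ a pa) (ι^ext Ξ b pb) d)

≤ᵃ-++⁺ˡ : ∀ {Γ Δ} Θ → Unique Θ → Disjoint Θ Γ → Disjoint Θ Δ → Γ ≤ᵃ Δ → (Θ ++ Γ) ≤ᵃ (Θ ++ Δ)
≤ᵃ-++⁺ˡ {Γ} {Δ} Θ uΘ dΘΓ dΘΔ (mk≤ᵃ ρ atomic) = mk≤ᵃ (ρ ^ext Θ) atomic^Θ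
  where
  atomic^Θ : IsAtomicReduction (Θ ++ Γ) (Θ ++ Δ) (ρ ^ext Θ)
  atomic^Θ Ξ fresh a b pa pb =
    HeadInjective-transport (++-assoc Ξ Θ Δ) (^ext-++ ρ Θ Ξ a pa' pa) (^ext-++ ρ Θ Ξ b pb' pb)
      (atomic (Ξ ++ Θ) (Fresh-++ uΘ dΘΓ dΘΔ fresh) a b pa' pb')
    where
    pa' : a ∈ (Ξ ++ Θ) ++ Γ
    pa' = subst (a ∈_) (sym (++-assoc Ξ Θ Γ)) pa
    pb' : b ∈ (Ξ ++ Θ) ++ Γ
    pb' = subst (b ∈_) (sym (++-assoc Ξ Θ Γ)) pb

lemmaL : (Γ Δ Θ : List Var) → Unique Γ → Unique Δ → Unique Θ →
    (Γ ⊆ Δ → Γ ≤ᵃ Δ) ×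
    (Γ ≤ᵃ Δ → Disjoint Θ Γ → Disjoint Θ Δ → (Θ ++ Γ) ≤ᵃ (Θ ++ Δ))
lemmaL Γ Δ Θ _ _ uΘ = ⊆⇒≤ᵃ , λ Γ≤Δ dΘΓ dΘΔ → ≤ᵃ-++⁺ˡ Θ uΘ dΘΓ dΘΔ Γ≤Δ
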